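{- Let $p$ denote an odd prime and $a,b\ge 1$. Then $$\Phi^*_n(-1)=\begin{cases}-2&n=1,\\ 0&n=2^a,\\ p^b&n=2^ap^b,\\ 1&\text{otherwise}.\end{cases}$$
   Context: $d\mid\mid n$ means $d\mid n$ and $\gcd(d,n/d)=1$; $(j,n)_*=\max\{d: d\mid j,\ d\mid\mid n\}$; $\Phi^*_n(x)=\prod_{1\le j\le n,\ (j,n)_*=1}(x-e^{2\pi i j/n})$ is the unitary cyclotomic polynomial. -}

module Defs where

open import Level using (Level; _⊔_)
open import Data.Nat as ℕ using (ℕ; zero; suc; _/_; _≡ᵇ_)
open import Data.Nat.Divisibility using (_∣?_)
open import Data.Nat.GCD using (gcd)
open import Data.Bool using (Bool; true; false; _∧_)
open import Data.List using (List; []; _∷_; foldr; filterᵇ; map; upTo)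
open import Data.Sum using (_⊎_)
open import Relation.Nullary using (¬_; does)
open import Relation.Binary.PropositionalEquality using (_≡_)
open import Algebra.Bundles using (CommutativeRing)

unitaryDiv? : ℕ → ℕ → Bool
unitaryDiv? zero      n = false
unitaryDiv? d@(suc _) n = does (d ∣? n) ∧ (gcd d (n / d) ≡ᵇ 1)

-- (j, n)_* = max { d : d ∣ j, d ∥ n }   (for n ≥ 1 every unitary divisor lies in 1..n)
unitaryGcd : ℕ → ℕ → ℕ
unitaryGcd j n =
  foldr ℕ._⊔_ 0 (filterᵇ (λ d → does (d ∣? j) ∧ unitaryDiv? d n) (map suc (upTo n)))

unitaryUnits : ℕ → List ℕ
unitaryUnits n = filterᵇ (λ j → unitaryGcd j n ≡ᵇ 1) (map suc (upTo n))

module _ {c ℓ : Level} (R : CommutativeRing c ℓ) where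
  open CommutativeRing R

  pow : Carrier → ℕ → Carrier
  pow x zero    = 1#
  pow x (suc k) = x * pow x k

  fromℕ : ℕ → Carrier
  fromℕ zero    = 0#
  fromℕ (suc m) = 1# + fromℕ m

  IsIntegralDomain : Set (c ⊔ ℓ)
  IsIntegralDomain = (¬ (1# ≈ 0#)) × (∀ x y → x * y ≈ 0# → (x ≈ 0#) ⊎ (y ≈ 0#))
    where open import Data.Product using (_×_)

  CharZero : Set ℓ
  CharZero = ∀ m → ¬ (fromℕ (suc m) ≈ 0#)

  PrimitiveRoot : ℕ → Carrier → Set ℓ
  PrimitiveRoot n ζ = (pow ζ n ≈ 1#) × (∀ k → 0 ℕ.< k → k ℕ.< n → ¬ (pow ζ k ≈ 1#))
    where open import Data.Product using (_×_)

  unitaryCyclotomicAt : ℕ → Carrier → Carrier → Carrier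
  unitaryCyclotomicAt n ζ x = foldr (λ j acc → (x - pow ζ j) * acc) 1# (unitaryUnits n)

module _ {c ℓ : Level} (R : CommutativeRing c ℓ) where
  open CommutativeRing R

  minusOne : Carrier
  minusOne = - 1#

  minusTwo : Carrier
  minusTwo = - (1# + 1#)

  EqR : Carrier → Carrier → Set ℓ
  EqR x y = x ≈ y

{-# OPTIONS --safe #-}
module Submission where

-- Let q = p^E be a prime power coprime to m and ζ a primitive (qm)-th root of unity, so that η = ζ^q
-- and ω = ζ^m are primitive m-th and q-th roots of unity.  The unitary divisors of qm are those of m
-- and q times those, so j is unitarily coprime to qm iff it is unitarily coprime to m and q ∤ j.
-- Take the product of x − ζ^j over the j < qm unitarily coprime to m.  Grouping j = r + tm (unitary
-- coprimality to m only depends on j mod m) and using that the ζ^r ω^t are the q-th roots of η^r, it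
-- is Φ*_m(η; x^q); splitting by whether q ∣ j, it is Φ*_qm(ζ; x) · Φ*_m(η; x).  Hence
--   Φ*_qm(ζ; x) · Φ*_m(η; x) = Φ*_m(η; x^q).
-- At x = −1 with q odd, and at x = 1 when m > 1, the factor Φ*_m(η; x) does not vanish and is fixed
-- by x ↦ x^q, so Φ*_qm(ζ; x) = 1.  This settles odd n > 1; with q = 2^a it reduces Φ*_(2^a m)(−1)
-- for odd m > 1 to Φ*_m(1), which is ∏_{0<j<p^b} (1 − ω^j) = p^b if m = p^b and 1 otherwise.
-- Finally Φ*_(2^a)(−1) = 0 since ζ^(2^(a−1)) = −1 is one of its roots.

open import Defs
open import Level using (Level)
open import Algebra.Bundles using (CommutativeMonoid; CommutativeRing)
open import Data.Bool.Base using (Bool; true; false; T; _∧_; not; if_then_else_)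
open import Data.Bool.Properties using (T-∧; T-≡; ⇔→≡; ∧-zeroʳ; ∧-identityʳ)
open import Data.Empty using (⊥-elim)
open import Data.List.Base using (List; []; _∷_; foldr; filter; filterᵇ; map; upTo; applyUpTo)
open import Data.List.Membership.Propositional using (_∈_)
open import Data.List.Membership.Propositional.Properties
  using (∈-filter⁺; ∈-filter⁻; ∈-map⁺; ∈-map⁻; ∈-upTo⁺)
open import Data.List.Properties using (foldr-preservesᵇ; map-applyUpTo)
open import Data.List.Relation.Unary.All as All using (_∷_)
open import Data.List.Relation.Unary.Any using (here; there)
open import Data.Maybe.Base using (nothing)
open import Data.Nat.Base as ℕ using (ℕ; zero; suc; _<_; _≤_; z≤n; s≤s; z<s; s<s)
import Data.Nat.Properties as ℕ
open import Data.Nat.Coprimality as Coprimality using (Coprime; coprime-divisor)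
open import Data.Nat.Divisibility
open import Data.Nat.Primality using (Prime; prime[2]; prime⇒nonZero)
open import Data.Product using (_×_; _,_; proj₁; proj₂; ∃-syntax)
open import Data.Sum using (inj₁; inj₂)
open import Data.Vec.Base using (Vec; []; _∷_; replicate)
open import Function.Base using (_∘_; const)
open import Function.Bundles using (_⇔_; mk⇔; Equivalence)
open import Function.Construct.Composition using (_⇔-∘_)
open import Function.Construct.Symmetry using (⇔-sym)
open import Relation.Binary.Definitions using (tri<; tri≈; tri>)
open import Relation.Binary.PropositionalEquality as ≡ using (_≡_; _≢_)
open import Relation.Nullary using (¬_; Dec; yes; no; does)
open import Relation.Nullary.Decidable using (T?; dec-true; dec-false)
open import Tactic.RingSolver using (solve-∀)
open import Tactic.RingSolver.Core.AlmostCommutativeRing using (fromCommutativeRing; AlmostCommutativeRing)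

module UnitaryDivisors where

  open import Data.Nat.Base
    using (_+_; _*_; _^_; _⊔_; _/_; _%_; _≡ᵇ_; NonZero; ≢-nonZero; >-nonZero; nonTrivial⇒n>1)
  open import Data.Nat.DivMod using (m*n/n≡m; m*[n/m]≡n; m≡m%n+[m/n]*n; m%n<n)
  open import Data.Nat.GCD using (gcd)
  open import Data.Nat.Induction using (<-wellFounded)
  open import Data.Nat.Primality using (prime⇒irreducible; prime⇒nonTrivial; euclidsLemma; ¬prime[1])
  open import Data.Nat.Primality.Factorisation using (factorise)
  open import Induction.WellFounded using (Acc; acc)
  open import Relation.Binary.PropositionalEquality
  open import Algebra.Properties.CommutativeSemigroup ℕ.*-commutativeSemigroup using (x∙yz≈y∙xz)

  infix 4 _∥_

  _∥_ : ℕ → ℕ → Set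
  d ∥ n = ∃[ e ] d * e ≡ n × Coprime d e

  UnitaryCoprime : ℕ → ℕ → Set
  UnitaryCoprime k n = ∀ d → d ∥ n → d ∣ k → d ≡ 1

  coprime-∣ˡ : ∀ {a b x} → x ∣ a → Coprime a b → Coprime x b
  coprime-∣ˡ x∣a cab (y∣x , y∣b) = cab (∣-trans y∣x x∣a , y∣b)

  coprime-*ʳ : ∀ {a b c} → Coprime a b → Coprime a c → Coprime a (b * c)
  coprime-*ʳ cab cac (y∣a , y∣bc) = cac (y∣a , coprime-divisor (coprime-∣ˡ y∣a cab) y∣bc)

  coprime-^ˡ : ∀ {a b} e → Coprime a b → Coprime (a ^ e) b
  coprime-^ˡ zero    _   = Coprimality.1-coprimeTo _
  coprime-^ˡ (suc e) cab =
    Coprimality.sym (coprime-*ʳ (Coprimality.sym cab) (Coprimality.sym (coprime-^ˡ e cab)))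

  prime∤⇒coprime : ∀ {p x} → Prime p → ¬ p ∣ x → Coprime p x
  prime∤⇒coprime p-prime p∤x (y∣p , y∣x) with prime⇒irreducible p-prime y∣p
  ... | inj₁ y≡1  = y≡1
  ... | inj₂ refl = ⊥-elim (p∤x y∣x)

  prime≢1 : ∀ {p} → Prime p → p ≢ 1
  prime≢1 p-prime refl = ¬prime[1] p-prime

  prime^≢1 : ∀ {p E} → Prime p → 1 ≤ E → p ^ E ≢ 1
  prime^≢1 {p} {suc E} p-prime _ = prime≢1 p-prime ∘ ℕ.m*n≡1⇒m≡1 p (p ^ E)

  prime∣^⇒∣ : ∀ {p a} e → Prime p → p ∣ a ^ e → p ∣ a
  prime∣^⇒∣ zero    p-prime p∣1 = ⊥-elim (prime≢1 p-prime (∣1⇒≡1 p∣1))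
  prime∣^⇒∣ {a = a} (suc e) p-prime p∣a^[1+e] with euclidsLemma a (a ^ e) p-prime p∣a^[1+e]
  ... | inj₁ p∣a   = p∣a
  ... | inj₂ p∣a^e = prime∣^⇒∣ e p-prime p∣a^e

  m∣m^n : ∀ {m n} → 0 < n → m ∣ m ^ n
  m∣m^n {m} {suc n} _ = m∣m*n (m ^ n)

  ∤⇒>0 : ∀ {p m} → ¬ p ∣ m → 0 < m
  ∤⇒>0 {p} {zero}  p∤0 = ⊥-elim (p∤0 (p ∣0))
  ∤⇒>0 {m = suc _} _   = z<s

  odd⇒%2≡1 : ∀ {k} → ¬ 2 ∣ k → k % 2 ≡ 1
  odd⇒%2≡1 {k} 2∤k with k % 2 in eq | m%n<n k 2
  ... | 0           | _               = ⊥-elim (2∤k (m%n≡0⇒n∣m k 2 eq))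
  ... | 1           | _               = refl
  ... | suc (suc _) | s≤s (s≤s ())

  %2≡1⇒odd : ∀ {k} → k % 2 ≡ 1 → ¬ 2 ∣ k
  %2≡1⇒odd {k} k%2≡1 2∣k with trans (sym k%2≡1) (n∣m⇒m%n≡0 k 2 2∣k)
  ... | ()

  odd⇒≡1+2* : ∀ {k} → ¬ 2 ∣ k → k ≡ suc (2 * (k / 2))
  odd⇒≡1+2* {k} 2∤k = trans (m≡m%n+[m/n]*n k 2) (cong₂ _+_ (odd⇒%2≡1 2∤k) (ℕ.*-comm (k / 2) 2))

  factorOut : ∀ {p} → 1 < p → ∀ {n} → 0 < n → ∃[ e ] ∃[ m ] n ≡ p ^ e * m × ¬ p ∣ m
  factorOut {p} 1<p {n} = go n (<-wellFounded n)
    where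
    go : ∀ n → Acc _<_ n → 0 < n → ∃[ e ] ∃[ m ] n ≡ p ^ e * m × ¬ p ∣ m
    go n _ _ with p ∣? n
    go n _ _           | no p∤n                     = 0 , n , sym (ℕ.+-identityʳ n) , p∤n
    go _ (acc rec) _   | yes (divides (suc q) refl) with go (suc q) (rec (ℕ.m<m*n (suc q) p 1<p)) z<s
    ... | e , m , q≡p^e*m , p∤m =
      suc e , m , trans (cong (_* p) q≡p^e*m) (trans (ℕ.*-comm _ p) (sym (ℕ.*-assoc p (p ^ e) m))) , p∤m

  primeDivisor : ∀ {n} → 0 < n → n ≢ 1 → ∃[ p ] Prime p × p ∣ n
  primeDivisor {n} n>0 n≢1 with factorise n {{>-nonZero n>0}}
  ... | record { factors = [] ; isFactorisation = refl } = ⊥-elim (n≢1 refl)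
  ... | record { factors = p ∷ _ ; isFactorisation = refl ; factorsPrime = p-prime ∷ _ } =
    p , p-prime , m∣m*n _

  primePowerFactor : ∀ {n} → 0 < n → n ≢ 1 →
                     ∃[ p ] ∃[ E ] ∃[ m ] Prime p × 1 ≤ E × ¬ p ∣ m × n ≡ p ^ E * m
  primePowerFactor n>0 n≢1 with primeDivisor n>0 n≢1
  ... | p , p-prime , p∣n with factorOut (nonTrivial⇒n>1 p {{prime⇒nonTrivial p-prime}}) n>0
  ...   | zero  , m , refl , p∤m = ⊥-elim (p∤m (subst (p ∣_) (ℕ.+-identityʳ m) p∣n))
  ...   | suc E , m , n≡ , p∤m   = p , suc E , m , p-prime , s≤s z≤n , p∤m , n≡

  ∥⇒∣ : ∀ {d n} → d ∥ n → d ∣ n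
  ∥⇒∣ (e , refl , _) = m∣m*n e

  ∥-refl : ∀ {n} → n ∥ n
  ∥-refl {n} = 1 , ℕ.*-identityʳ n , λ (_ , y∣1) → ∣1⇒≡1 y∣1

  unitaryCoprime-1 : ∀ {k} → UnitaryCoprime k 1
  unitaryCoprime-1 d (e , de≡1 , _) _ = ℕ.m*n≡1⇒m≡1 d e de≡1

  ¬unitaryCoprime-0 : ∀ {n} → n ≢ 1 → ¬ UnitaryCoprime 0 n
  ¬unitaryCoprime-0 {n} n≢1 uc = n≢1 (uc n ∥-refl (n ∣0))

  unitaryCoprime-self⇔0 : ∀ {n} → UnitaryCoprime n n ⇔ UnitaryCoprime 0 n
  unitaryCoprime-self⇔0 = mk⇔
    (λ uc d d∥n _ → uc d d∥n (∥⇒∣ d∥n))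
    (λ uc d d∥n _ → uc d d∥n (d ∣0))

  unitaryCoprime-periodic : ∀ t {n r} → UnitaryCoprime (t * n + r) n ⇔ UnitaryCoprime r n
  unitaryCoprime-periodic t = mk⇔
    (λ uc d d∥n d∣r → uc d d∥n (∣m∣n⇒∣m+n (∣n⇒∣m*n t (∥⇒∣ d∥n)) d∣r))
    (λ uc d d∥n d∣k → uc d d∥n (∣m+n∣m⇒∣n d∣k (∣n⇒∣m*n t (∥⇒∣ d∥n))))

  unitaryCoprime-*ʳ : ∀ {q n} s → Coprime q n → UnitaryCoprime (s * q) n ⇔ UnitaryCoprime s n
  unitaryCoprime-*ʳ {q} s cqn = mk⇔
    (λ uc d d∥n d∣s  → uc d d∥n (∣m⇒∣m*n q d∣s))
    (λ uc d d∥n d∣sq → uc d d∥n (coprime-divisor (coprime-∣ˡ (∥⇒∣ d∥n) (Coprimality.sym cqn))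
                                                 (subst (d ∣_) (ℕ.*-comm s q) d∣sq)))

  module _ {p E m} (p-prime : Prime p) (E≥1 : 1 ≤ E) (p∤m : ¬ p ∣ m) where

    private
      q = p ^ E

      q-coprime : ∀ {x} → ¬ p ∣ x → Coprime q x
      q-coprime = coprime-^ˡ E ∘ prime∤⇒coprime p-prime

    unitaryCoprime-primePower* : ∀ {k} → UnitaryCoprime k (q * m) ⇔ (¬ q ∣ k × UnitaryCoprime k m)
    unitaryCoprime-primePower* {k} = mk⇔ (λ uc → q∤k uc , lower uc) raise
      where
      q∤k : UnitaryCoprime k (q * m) → ¬ q ∣ k
      q∤k uc q∣k = prime^≢1 p-prime E≥1 (uc q (m , refl , q-coprime p∤m) q∣k)

      lower : UnitaryCoprime k (q * m) → UnitaryCoprime k m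
      lower uc d (e , refl , cde) = uc d (q * e , x∙yz≈y∙xz d q e , coprime-*ʳ cdq cde)
        where
        cdq : Coprime d q
        cdq = coprime-∣ˡ (m∣m*n e) (Coprimality.sym (q-coprime p∤m))

      raise : ¬ q ∣ k × UnitaryCoprime k m → UnitaryCoprime k (q * m)
      raise (q∤k , uc) d (e , de≡qm , cde) d∣k with p ∣? d
      ... | yes p∣d = ⊥-elim (q∤k (∣-trans q∣d d∣k))
        where
        q∣d : q ∣ d
        q∣d = coprime-divisor (q-coprime (λ p∣e → prime≢1 p-prime (cde (p∣d , p∣e))))
                              (subst (q ∣_) (trans (sym de≡qm) (ℕ.*-comm d e)) (m∣m*n m))
      ... | no p∤d = uc d (f , df≡m , cdf) d∣k
        where
        d∣m : d ∣ m
        d∣m = coprime-divisor (Coprimality.sym (q-coprime p∤d)) (subst (d ∣_) de≡qm (m∣m*n e))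

        f = quotient d∣m

        df≡m : d * f ≡ m
        df≡m = sym (m∣n⇒n≡m*quotient d∣m)

        instance
          d≢0 : NonZero d
          d≢0 = ≢-nonZero λ { refl → p∤m (subst (p ∣_) df≡m (p ∣0)) }

        e≡qf : e ≡ q * f
        e≡qf = ℕ.*-cancelˡ-≡ e (q * f) d
                 (trans de≡qm (trans (cong (q *_) (sym df≡m)) (x∙yz≈y∙xz q d f)))

        cdf : Coprime d f
        cdf = Coprimality.sym (coprime-∣ˡ (subst (f ∣_) (sym e≡qf) (n∣m*n q)) (Coprimality.sym cde))

  unitaryCoprime-primePower : ∀ {p E k} → Prime p → 1 ≤ E → ¬ p ^ E ∣ k → UnitaryCoprime k (p ^ E)
  unitaryCoprime-primePower {p} {E} p-prime E≥1 q∤k =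
    subst (UnitaryCoprime _) (ℕ.*-identityʳ (p ^ E))
          (Equivalence.from (unitaryCoprime-primePower* p-prime E≥1 (prime≢1 p-prime ∘ ∣1⇒≡1))
                            (q∤k , unitaryCoprime-1))

  isUnitaryCoprime : ℕ → ℕ → Bool
  isUnitaryCoprime k n = unitaryGcd k n ≡ᵇ 1

  T-does⇔ : ∀ {a} {A : Set a} (a? : Dec A) → T (does a?) ⇔ A
  T-does⇔ (yes a) = mk⇔ (λ _ → a) _
  T-does⇔ (no ¬a) = mk⇔ (λ ()) ¬a

  T-not-does⇔ : ∀ {a} {A : Set a} (a? : Dec A) → T (not (does a?)) ⇔ (¬ A)
  T-not-does⇔ (yes a) = mk⇔ (λ ()) (λ ¬a → ¬a a)
  T-not-does⇔ (no ¬a) = mk⇔ (λ _ → ¬a) _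

  ∈⇒≤foldr-⊔ : ∀ {x xs} → x ∈ xs → x ≤ foldr _⊔_ 0 xs
  ∈⇒≤foldr-⊔ {xs = y ∷ _} (here refl) = ℕ.m≤m⊔n y _
  ∈⇒≤foldr-⊔ {xs = y ∷ _} (there x∈) = ℕ.m≤n⇒m≤o⊔n y (∈⇒≤foldr-⊔ x∈)

  T-unitaryDiv? : ∀ d {n} → T (unitaryDiv? (suc d) n) ⇔ suc d ∥ n
  T-unitaryDiv? d {n} = mk⇔ to from
    where
    to : T (unitaryDiv? (suc d) n) → suc d ∥ n
    to t = n / suc d , m*[n/m]≡n d∣n , Coprimality.gcd≡1⇒coprime (ℕ.≡ᵇ⇒≡ _ 1 (proj₂ t∧))
      where
      t∧  = Equivalence.to T-∧ t
      d∣n = Equivalence.to (T-does⇔ (suc d ∣? n)) (proj₁ t∧)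

    from : suc d ∥ n → T (unitaryDiv? (suc d) n)
    from (e , refl , c) = Equivalence.from T-∧
      ( Equivalence.from (T-does⇔ (suc d ∣? _)) (m∣m*n e)
      , ℕ.≡⇒≡ᵇ _ 1 (trans (cong (gcd (suc d)) [de]/d≡e) (Coprimality.coprime⇒gcd≡1 c)))
      where
      [de]/d≡e : suc d * e / suc d ≡ e
      [de]/d≡e = trans (cong (_/ suc d) (ℕ.*-comm (suc d) e)) (m*n/n≡m e (suc d))

  -- unitaryGcd k n is the largest of the candidates below, and 1 is always one of them.
  T-isUnitaryCoprime⇔ : ∀ {k n} → 0 < n → T (isUnitaryCoprime k n) ⇔ UnitaryCoprime k n
  T-isUnitaryCoprime⇔ {k} {n} n>0 = mk⇔ to from
    where
    selects : ℕ → Bool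
    selects d = does (d ∣? k) ∧ unitaryDiv? d n

    T-selects : ∀ d → T (selects (suc d)) ⇔ (suc d ∣ k × suc d ∥ n)
    T-selects d = mk⇔
      (λ t → let (t∣ , t∥) = Equivalence.to T-∧ t
             in Equivalence.to (T-does⇔ (suc d ∣? k)) t∣ , Equivalence.to (T-unitaryDiv? d) t∥)
      (λ (d∣k , d∥n) → Equivalence.from T-∧
        (Equivalence.from (T-does⇔ (suc d ∣? k)) d∣k , Equivalence.from (T-unitaryDiv? d) d∥n))

    candidates : List ℕ
    candidates = filter (T? ∘ selects) (map suc (upTo n))

    candidate⁺ : ∀ d → suc d ∣ k → suc d ∥ n → suc d ∈ candidates
    candidate⁺ d d∣k d∥n = ∈-filter⁺ (T? ∘ selects)
      (∈-map⁺ suc (∈-upTo⁺ (∣⇒≤ {{>-nonZero n>0}} (∥⇒∣ d∥n))))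
      (Equivalence.from (T-selects d) (d∣k , d∥n))

    candidate≤1 : UnitaryCoprime k n → ∀ {d} → d ∈ candidates → d ≤ 1
    candidate≤1 uc d∈ with ∈-filter⁻ (T? ∘ selects) {xs = map suc (upTo n)} d∈
    ... | d∈ns , t with ∈-map⁻ suc {xs = upTo n} d∈ns
    ...   | i , _ , refl = ℕ.≤-reflexive (uc (suc i) (proj₂ d∣k×d∥n) (proj₁ d∣k×d∥n))
      where
      d∣k×d∥n = Equivalence.to (T-selects i) t

    to : T (isUnitaryCoprime k n) → UnitaryCoprime k n
    to t zero    (_ , 0≡n , _) _ = ⊥-elim (ℕ.<⇒≢ n>0 0≡n)
    to t (suc d) d∥n d∣k = ℕ.≤-antisym
      (subst (suc d ≤_) (ℕ.≡ᵇ⇒≡ _ 1 t) (∈⇒≤foldr-⊔ (candidate⁺ d d∣k d∥n)))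
      (s≤s z≤n)

    from : UnitaryCoprime k n → T (isUnitaryCoprime k n)
    from uc = ℕ.≡⇒≡ᵇ _ 1 (ℕ.≤-antisym
      (foldr-preservesᵇ ℕ.⊔-lub z≤n (All.tabulate (candidate≤1 uc)))
      (∈⇒≤foldr-⊔ (candidate⁺ 0 (1∣ k) (n , ℕ.*-identityˡ n , Coprimality.1-coprimeTo n))))

  isUnitaryCoprime-≡ : ∀ {k n k′ n′} → 0 < n → 0 < n′ →
                       UnitaryCoprime k n ⇔ UnitaryCoprime k′ n′ →
                       isUnitaryCoprime k n ≡ isUnitaryCoprime k′ n′
  isUnitaryCoprime-≡ n>0 n′>0 uc⇔ = ⇔→≡ {z = true}
    (T-≡ ⇔-∘ (⇔-sym (T-isUnitaryCoprime⇔ n′>0) ⇔-∘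
      (uc⇔ ⇔-∘ (T-isUnitaryCoprime⇔ n>0 ⇔-∘ ⇔-sym T-≡))))

  isUnitaryCoprime-false : ∀ {k n} → 0 < n → ¬ UnitaryCoprime k n → isUnitaryCoprime k n ≡ false
  isUnitaryCoprime-false {k} {n} n>0 ¬uc with isUnitaryCoprime k n in eq
  ... | false = refl
  ... | true  = ⊥-elim (¬uc (Equivalence.to (T-isUnitaryCoprime⇔ n>0) (subst T (sym eq) _)))

  isUnitaryCoprime-primePower* : ∀ {p E m k} → Prime p → 1 ≤ E → ¬ p ∣ m →
    isUnitaryCoprime k (p ^ E * m) ≡ isUnitaryCoprime k m ∧ not (does (p ^ E ∣? k))
  isUnitaryCoprime-primePower* {p} {E} {m} {k} p-prime E≥1 p∤m = ⇔→≡ {z = true}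
    (T-≡ ⇔-∘ (⇔-sym T-∧ ⇔-∘ (rearrange ⇔-∘ (unitaryCoprime-primePower* p-prime E≥1 p∤m ⇔-∘
      (T-isUnitaryCoprime⇔ n>0 ⇔-∘ ⇔-sym T-≡)))))
    where
    n>0 : 0 < p ^ E * m
    n>0 = ℕ.*-mono-≤ (ℕ.m^n>0 p {{prime⇒nonZero p-prime}} E) (∤⇒>0 p∤m)

    T-uc⇔ = T-isUnitaryCoprime⇔ (∤⇒>0 p∤m)
    T-∤⇔  = T-not-does⇔ (p ^ E ∣? k)

    rearrange : (¬ p ^ E ∣ k × UnitaryCoprime k m) ⇔
                (T (isUnitaryCoprime k m) × T (not (does (p ^ E ∣? k))))
    rearrange = mk⇔
      (λ (q∤k , uc) → Equivalence.from T-uc⇔ uc , Equivalence.from T-∤⇔ q∤k)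
      (λ (t , t′)   → Equivalence.to T-∤⇔ t′ , Equivalence.to T-uc⇔ t)

open UnitaryDivisors

module RangeProduct {c ℓ} (M : CommutativeMonoid c ℓ) where

  open CommutativeMonoid M
  open import Data.Nat.Base using (_+_; _*_)
  open import Relation.Binary.Reasoning.Setoid setoid
  open import Algebra.Properties.CommutativeSemigroup commutativeSemigroup using (interchange)

  ∏< : ℕ → (ℕ → Carrier) → Carrier
  ∏< zero    f = ε
  ∏< (suc n) f = f 0 ∙ ∏< n (f ∘ suc)

  ∏<-cong : ∀ n {f g} → (∀ {k} → k < n → f k ≈ g k) → ∏< n f ≈ ∏< n g
  ∏<-cong zero    f≈g = refl
  ∏<-cong (suc n) f≈g = ∙-cong (f≈g z<s) (∏<-cong n (f≈g ∘ s<s))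

  ∏<-identity : ∀ n → ∏< n (const ε) ≈ ε
  ∏<-identity zero    = refl
  ∏<-identity (suc n) = trans (identityˡ _) (∏<-identity n)

  ∏<-distrib : ∀ n f g → ∏< n (λ k → f k ∙ g k) ≈ ∏< n f ∙ ∏< n g
  ∏<-distrib zero    f g = sym (identityˡ ε)
  ∏<-distrib (suc n) f g = trans (∙-congˡ (∏<-distrib n (f ∘ suc) (g ∘ suc))) (interchange _ _ _ _)

  ∏<-suc : ∀ n f → ∏< (suc n) f ≈ ∏< n f ∙ f n
  ∏<-suc zero    f = trans (identityʳ _) (sym (identityˡ _))
  ∏<-suc (suc n) f = trans (∙-congˡ (∏<-suc n (f ∘ suc))) (sym (assoc _ _ _))

  ∏<-+ : ∀ a b f → ∏< (a + b) f ≈ ∏< a f ∙ ∏< b (λ k → f (a + k))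
  ∏<-+ zero    b f = sym (identityˡ _)
  ∏<-+ (suc a) b f = trans (∙-congˡ (∏<-+ a b (f ∘ suc))) (sym (assoc _ _ _))

  ∏<-* : ∀ a b f → ∏< (a * b) f ≈ ∏< a (λ t → ∏< b (λ r → f (t * b + r)))
  ∏<-* zero    b f = refl
  ∏<-* (suc a) b f = begin
    ∏< (b + a * b) f
      ≈⟨ ∏<-+ b (a * b) f ⟩
    ∏< b f ∙ ∏< (a * b) (λ k → f (b + k))
      ≈⟨ ∙-congˡ (∏<-* a b _) ⟩
    ∏< b f ∙ ∏< a (λ t → ∏< b (λ r → f (b + (t * b + r))))
      ≈⟨ ∙-congˡ (∏<-cong a λ {t} _ → ∏<-cong b λ {r} _ →
           reflexive (≡.cong f (≡.sym (ℕ.+-assoc b (t * b) r)))) ⟩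
    ∏< b f ∙ ∏< a (λ t → ∏< b (λ r → f (suc t * b + r)))
      ∎

  ∏<-comm : ∀ a b (f : ℕ → ℕ → Carrier) →
            ∏< a (λ i → ∏< b (f i)) ≈ ∏< b (λ j → ∏< a (λ i → f i j))
  ∏<-comm zero    b f = sym (∏<-identity b)
  ∏<-comm (suc a) b f = begin
    ∏< b (f 0) ∙ ∏< a (λ i → ∏< b (f (suc i)))          ≈⟨ ∙-congˡ (∏<-comm a b (f ∘ suc)) ⟩
    ∏< b (f 0) ∙ ∏< b (λ j → ∏< a (λ i → f (suc i) j))  ≈⟨ ∏<-distrib b _ _ ⟨
    ∏< b (λ j → f 0 j ∙ ∏< a (λ i → f (suc i) j))       ∎

  ∏<-head : ∀ {n} f → 0 < n → (∀ {k} → suc k < n → f (suc k) ≈ ε) → ∏< n f ≈ f 0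
  ∏<-head {suc n} f _ tail≈ε =
    trans (∙-congˡ (trans (∏<-cong n (tail≈ε ∘ s<s)) (∏<-identity n))) (identityʳ _)

  ∏<-rotate : ∀ n f → f n ≈ f 0 → ∏< n (f ∘ suc) ≈ ∏< n f
  ∏<-rotate zero    f _     = refl
  ∏<-rotate (suc n) f fn≈f0 = begin
    ∏< (suc n) (f ∘ suc)        ≈⟨ ∏<-suc n (f ∘ suc) ⟩
    ∏< n (f ∘ suc) ∙ f (suc n)  ≈⟨ ∙-congˡ fn≈f0 ⟩
    ∏< n (f ∘ suc) ∙ f 0        ≈⟨ comm _ _ ⟩
    f 0 ∙ ∏< n (f ∘ suc)        ∎

module IntegralDomain {c ℓ} (R : CommutativeRing c ℓ) (domain : IsIntegralDomain R) where

  open CommutativeRing R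
  open import Relation.Binary.Reasoning.Setoid setoid
  open import Algebra.Properties.Ring ring
    using ( x∙y⁻¹≈ε⇒x≈y; x≈y⇒x∙y⁻¹≈ε; x[y-z]≈xy-xz; [y-z]x≈yx-zx; +-cancelʳ; +-inverseˡ-unique
          ; -‿involutive; -1*x≈-x)
  open import Algebra.Properties.Semiring.Exp semiring using (_^_; ^-congˡ; ^-homo-*; ^-assocʳ)
  open import Algebra.Properties.CommutativeSemiring.Exp commutativeSemiring using (^-distrib-*)
  open RangeProduct *-commutativeMonoid public

  1#≉0# : ¬ 1# ≈ 0#
  1#≉0# = proj₁ domain

  *-nonzero : ∀ {x y} → ¬ x ≈ 0# → ¬ y ≈ 0# → ¬ x * y ≈ 0#
  *-nonzero x≉0 y≉0 xy≈0 with proj₂ domain _ _ xy≈0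
  ... | inj₁ x≈0 = x≉0 x≈0
  ... | inj₂ y≈0 = y≉0 y≈0

  *-cancelˡ : ∀ {x y z} → ¬ x ≈ 0# → x * y ≈ x * z → y ≈ z
  *-cancelˡ {x} {y} {z} x≉0 xy≈xz
    with proj₂ domain x (y - z) (trans (x[y-z]≈xy-xz x y z) (x≈y⇒x∙y⁻¹≈ε xy≈xz))
  ... | inj₁ x≈0   = ⊥-elim (x≉0 x≈0)
  ... | inj₂ y-z≈0 = x∙y⁻¹≈ε⇒x≈y y z y-z≈0

  *-identityˡ-unique : ∀ {x y} → ¬ y ≈ 0# → x * y ≈ y → x ≈ 1#
  *-identityˡ-unique {x} {y} y≉0 xy≈y = *-cancelˡ y≉0 (begin
    y * x  ≈⟨ *-comm y x ⟩
    x * y  ≈⟨ xy≈y ⟩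
    y      ≈⟨ *-identityʳ y ⟨
    y * 1# ∎)

  ∏<-zero : ∀ n {f k} → k < n → f k ≈ 0# → ∏< n f ≈ 0#
  ∏<-zero (suc n) {k = zero}  _         f0≈0 = trans (*-congʳ f0≈0) (zeroˡ _)
  ∏<-zero (suc n) {k = suc k} (s<s k<n) fk≈0 = trans (*-congˡ (∏<-zero n k<n fk≈0)) (zeroʳ _)

  ∏<-nonzero : ∀ n {f} → (∀ {k} → k < n → ¬ f k ≈ 0#) → ¬ ∏< n f ≈ 0#
  ∏<-nonzero zero    _    = 1#≉0#
  ∏<-nonzero (suc n) f≉0 = *-nonzero (f≉0 z<s) (∏<-nonzero n (f≉0 ∘ s<s))

  pow≡^ : ∀ x k → pow R x k ≡ x ^ k
  pow≡^ x zero    = ≡.refl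
  pow≡^ x (suc k) = ≡.cong (x *_) (pow≡^ x k)

  pow-congˡ : ∀ {x y} k → x ≈ y → pow R x k ≈ pow R y k
  pow-congˡ {x} {y} k x≈y rewrite pow≡^ x k | pow≡^ y k = ^-congˡ k x≈y

  pow-homo-* : ∀ x m n → pow R x (m ℕ.+ n) ≈ pow R x m * pow R x n
  pow-homo-* x m n rewrite pow≡^ x (m ℕ.+ n) | pow≡^ x m | pow≡^ x n = ^-homo-* x m n

  pow-assocʳ : ∀ x m n → pow R (pow R x m) n ≈ pow R x (m ℕ.* n)
  pow-assocʳ x m n rewrite pow≡^ (pow R x m) n | pow≡^ x m | pow≡^ x (m ℕ.* n) = ^-assocʳ x m n

  pow-distrib-* : ∀ x y n → pow R (x * y) n ≈ pow R x n * pow R y n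
  pow-distrib-* x y n rewrite pow≡^ (x * y) n | pow≡^ x n | pow≡^ y n = ^-distrib-* x y n

  pow-1# : ∀ n → pow R 1# n ≈ 1#
  pow-1# zero    = refl
  pow-1# (suc n) = trans (*-identityˡ _) (pow-1# n)

  pow-zeroˡ : ∀ {n} → 0 < n → pow R 0# n ≈ 0#
  pow-zeroˡ {suc n} _ = zeroˡ _

  pow-nonzero : ∀ {x} n → ¬ x ≈ 0# → ¬ pow R x n ≈ 0#
  pow-nonzero zero    _   = 1#≉0#
  pow-nonzero (suc n) x≉0 = *-nonzero x≉0 (pow-nonzero n x≉0)

  private
    acr = fromCommutativeRing R (λ _ → nothing)
    module S = AlmostCommutativeRing acr

  x≈y+z⇒z≈0⇒x≈y : ∀ {x y z} → x ≈ y + z → z ≈ 0# → x ≈ y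
  x≈y+z⇒z≈0⇒x≈y {x} {y} {z} x≈y+z z≈0 = trans x≈y+z (trans (+-congˡ z≈0) (+-identityʳ y))

  [r-r]*x≈0 : ∀ {r} x → (r - r) * x ≈ 0#
  [r-r]*x≈0 {r} x = trans (*-congʳ (-‿inverseʳ r)) (zeroˡ x)

  -- eval cs y = c₀ + c₁ y + ⋯ + c_(d−1) y^(d−1) + y^d: the monic polynomial of degree d with lower
  -- coefficients cs, in Horner form.
  eval : ∀ {d} → Vec Carrier d → Carrier → Carrier
  eval []       y = 1#
  eval (c ∷ cs) y = c + y * eval cs y

  divide : ∀ {d} → Carrier → Vec Carrier (suc d) → Vec Carrier d
  divide r (c ∷ [])         = []
  divide r (c ∷ cs@(_ ∷ _)) = eval cs r ∷ divide r cs

  eval-divide : ∀ {d} r (cs : Vec Carrier (suc d)) y →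
                eval cs y ≈ (y - r) * eval (divide r cs) y + eval cs r
  -- The ring solver does not normalise negations here, so −r is abstracted as s and r + s ≈ 0 is
  -- discharged separately.
  eval-divide r (c ∷ []) y = sym (x≈y+z⇒z≈0⇒x≈y (identity c y r (- r) 1#) ([r-r]*x≈0 1#))
    where
    identity : ∀ c y r s B →
               (y S.+ s) S.* B S.+ (c S.+ r S.* B) S.≈ (c S.+ y S.* B) S.+ (r S.+ s) S.* B
    identity = solve-∀ acr
  eval-divide r (c ∷ cs@(_ ∷ _)) y = begin
    c + y * eval cs y                    ≈⟨ +-congˡ (*-congˡ (eval-divide r cs y)) ⟩
    c + y * ((y - r) * Q + B)            ≈⟨ x≈y+z⇒z≈0⇒x≈y (identity c y r (- r) B Q) ([r-r]*x≈0 B) ⟨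
    (y - r) * (B + y * Q) + (c + r * B)  ∎
    where
    B = eval cs r
    Q = eval (divide r cs) y
    identity : ∀ c y r s B Q → (y S.+ s) S.* (B S.+ y S.* Q) S.+ (c S.+ r S.* B)
                               S.≈ (c S.+ y S.* ((y S.+ s) S.* Q S.+ B)) S.+ (r S.+ s) S.* B
    identity = solve-∀ acr

  eval≈∏<roots : ∀ d (cs : Vec Carrier d) (r : ℕ → Carrier) →
                 (∀ {i j} → i < d → j < d → r i ≈ r j → i ≡ j) →
                 (∀ {i} → i < d → eval cs (r i) ≈ 0#) →
                 ∀ y → eval cs y ≈ ∏< d (λ i → y - r i)
  eval≈∏<roots zero    []       r _        _     y = refl
  eval≈∏<roots (suc d) cs@(_ ∷ _) r distinct roots y = begin
    eval cs y                               ≈⟨ x≈y+z⇒z≈0⇒x≈y (eval-divide (r 0) cs y) (roots z<s) ⟩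
    (y - r 0) * eval q y                    ≈⟨ *-congˡ (eval≈∏<roots d q (r ∘ suc) distinct′ roots′ y) ⟩
    (y - r 0) * ∏< d (λ i → y - r (suc i))  ∎
    where
    q = divide (r 0) cs

    distinct′ : ∀ {i j} → i < d → j < d → r (suc i) ≈ r (suc j) → i ≡ j
    distinct′ i<d j<d ri≈rj = ℕ.suc-injective (distinct (s<s i<d) (s<s j<d) ri≈rj)

    roots′ : ∀ {i} → i < d → eval q (r (suc i)) ≈ 0#
    roots′ {i} i<d with proj₂ domain (r (suc i) - r 0) (eval q (r (suc i))) (begin
      (r (suc i) - r 0) * eval q (r (suc i))                     ≈⟨ +-identityʳ _ ⟨
      (r (suc i) - r 0) * eval q (r (suc i)) + 0#                ≈⟨ +-congˡ (roots z<s) ⟨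
      (r (suc i) - r 0) * eval q (r (suc i)) + eval cs (r 0)     ≈⟨ eval-divide (r 0) cs (r (suc i)) ⟨
      eval cs (r (suc i))                                        ≈⟨ roots (s<s i<d) ⟩
      0#                                                         ∎)
    ... | inj₁ ri-r0≈0 = ⊥-elim (ℕ.1+n≢0 (distinct (s<s i<d) z<s (x∙y⁻¹≈ε⇒x≈y _ _ ri-r0≈0)))
    ... | inj₂ q≈0     = q≈0

  x*y≈y⇒y≈0 : ∀ {x y} → ¬ x ≈ 1# → x * y ≈ y → y ≈ 0#
  x*y≈y⇒y≈0 {x} {y} x≉1 xy≈y with proj₂ domain (x - 1#) y (begin
    (x - 1#) * y    ≈⟨ [y-z]x≈yx-zx y x 1# ⟩
    x * y - 1# * y  ≈⟨ +-cong xy≈y (-‿cong (*-identityˡ y)) ⟩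
    y - y           ≈⟨ -‿inverseʳ y ⟩
    0#              ∎)
  ... | inj₁ x-1≈0 = ⊥-elim (x≉1 (x∙y⁻¹≈ε⇒x≈y x 1# x-1≈0))
  ... | inj₂ y≈0   = y≈0

  x²≈1⇒x≈-1 : ∀ {x} → x * x ≈ 1# → ¬ x ≈ 1# → x ≈ - 1#
  x²≈1⇒x≈-1 {x} x²≈1 x≉1 = +-inverseˡ-unique x 1# (x*y≈y⇒y≈0 x≉1 (begin
    x * (x + 1#)       ≈⟨ distribˡ x x 1# ⟩
    x * x + x * 1#     ≈⟨ +-cong x²≈1 (*-identityʳ x) ⟩
    1# + x             ≈⟨ +-comm 1# x ⟩
    x + 1#             ∎))

  pow-[-1]-even : ∀ j → pow R (- 1#) (2 ℕ.* j) ≈ 1#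
  pow-[-1]-even j = begin
    pow R (- 1#) (2 ℕ.* j)           ≈⟨ pow-assocʳ (- 1#) 2 j ⟨
    pow R (pow R (- 1#) 2) j         ≈⟨ pow-congˡ j [-1]²≈1 ⟩
    pow R 1# j                       ≈⟨ pow-1# j ⟩
    1#                               ∎
    where
    [-1]²≈1 : - 1# * (- 1# * 1#) ≈ 1#
    [-1]²≈1 = trans (-1*x≈-x _) (trans (-‿cong (*-identityʳ (- 1#))) (-‿involutive 1#))

  pow-[-1]-odd : ∀ {k} → ¬ 2 ∣ k → pow R (- 1#) k ≈ - 1#
  pow-[-1]-odd {k} 2∤k = begin
    pow R (- 1#) k                              ≡⟨ ≡.cong (pow R (- 1#)) (odd⇒≡1+2* 2∤k) ⟩
    - 1# * pow R (- 1#) (2 ℕ.* (k ℕ./ 2))       ≈⟨ *-congˡ (pow-[-1]-even (k ℕ./ 2)) ⟩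
    - 1# * 1#                                   ≈⟨ *-identityʳ (- 1#) ⟩
    - 1#                                        ∎

  module _ {n ζ} (ζ-primitive : PrimitiveRoot R n ζ) where

    private
      ζⁿ≈1 = proj₁ ζ-primitive

    primitive⇒nonzero : 0 < n → ¬ ζ ≈ 0#
    primitive⇒nonzero n>0 ζ≈0 = 1#≉0# (begin
      1#            ≈⟨ ζⁿ≈1 ⟨
      pow R ζ n     ≈⟨ pow-congˡ n ζ≈0 ⟩
      pow R 0# n    ≈⟨ pow-zeroˡ n>0 ⟩
      0#            ∎)

    pow-multiple≈1 : ∀ t → pow R ζ (t ℕ.* n) ≈ 1#
    pow-multiple≈1 t = begin
      pow R ζ (t ℕ.* n)     ≡⟨ ≡.cong (pow R ζ) (ℕ.*-comm t n) ⟩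
      pow R ζ (n ℕ.* t)     ≈⟨ pow-assocʳ ζ n t ⟨
      pow R (pow R ζ n) t   ≈⟨ pow-congˡ t ζⁿ≈1 ⟩
      pow R 1# t            ≈⟨ pow-1# t ⟩
      1#                    ∎

    pow-distinct : 0 < n → ∀ {a b} → a < b → b < n → ¬ pow R ζ a ≈ pow R ζ b
    pow-distinct n>0 {a} {b} a<b b<n ζᵃ≈ζᵇ = proj₂ ζ-primitive (b ℕ.∸ a) (ℕ.m<n⇒0<n∸m a<b)
      (ℕ.≤-<-trans (ℕ.m∸n≤m b a) b<n)
      (sym (*-cancelˡ (pow-nonzero a (primitive⇒nonzero n>0)) (begin
        pow R ζ a * 1#                  ≈⟨ *-identityʳ _ ⟩
        pow R ζ a                       ≈⟨ ζᵃ≈ζᵇ ⟩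
        pow R ζ b                       ≡⟨ ≡.cong (pow R ζ) (ℕ.m+[n∸m]≡n (ℕ.<⇒≤ a<b)) ⟨
        pow R ζ (a ℕ.+ (b ℕ.∸ a))       ≈⟨ pow-homo-* ζ a (b ℕ.∸ a) ⟩
        pow R ζ a * pow R ζ (b ℕ.∸ a)   ∎)))

    pow-injective : 0 < n → ∀ {a b} → a < n → b < n → pow R ζ a ≈ pow R ζ b → a ≡ b
    pow-injective n>0 {a} {b} a<n b<n ζᵃ≈ζᵇ with ℕ.<-cmp a b
    ... | tri≈ _ a≡b _ = a≡b
    ... | tri< a<b _ _ = ⊥-elim (pow-distinct n>0 a<b b<n ζᵃ≈ζᵇ)
    ... | tri> _ _ b<a = ⊥-elim (pow-distinct n>0 b<a a<n (sym ζᵃ≈ζᵇ))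

  primitive-pow : ∀ {q m ζ} → 0 < q → PrimitiveRoot R (q ℕ.* m) ζ → PrimitiveRoot R m (pow R ζ q)
  primitive-pow {q@(suc _)} {m} {ζ} _ (ζ^qm≈1 , minimal) = trans (pow-assocʳ ζ q m) ζ^qm≈1 , minimal′
    where
    minimal′ : ∀ k → 0 < k → k < m → ¬ pow R (pow R ζ q) k ≈ 1#
    minimal′ k@(suc _) _ k<m ηᵏ≈1 =
      minimal (q ℕ.* k) z<s (ℕ.*-monoʳ-< q k<m) (trans (sym (pow-assocʳ ζ q k)) ηᵏ≈1)

  eval-replicate-0# : ∀ k y → eval (replicate k 0#) y ≈ pow R y k
  eval-replicate-0# zero    y = refl
  eval-replicate-0# (suc k) y = trans (+-identityˡ _) (*-congˡ (eval-replicate-0# k y))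

  x^Q-ρ^Q≈∏< : ∀ {Q ω} → 0 < Q → PrimitiveRoot R Q ω → ∀ {ρ} → ¬ ρ ≈ 0# → ∀ x →
               pow R x Q - pow R ρ Q ≈ ∏< Q (λ t → x - ρ * pow R ω t)
  x^Q-ρ^Q≈∏< {Q@(suc Q-1)} {ω} Q>0 ω-primitive {ρ} ρ≉0 x = begin
    pow R x Q - ρ^Q                       ≈⟨ eval-cs x ⟨
    eval cs x                             ≈⟨ eval≈∏<roots Q cs r distinct roots x ⟩
    ∏< Q (λ t → x - ρ * pow R ω t)        ∎
    where
    ρ^Q = pow R ρ Q
    cs  = - ρ^Q ∷ replicate Q-1 0#

    r : ℕ → Carrier
    r t = ρ * pow R ω t

    eval-cs : ∀ y → eval cs y ≈ pow R y Q - ρ^Q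
    eval-cs y = trans (+-congˡ (*-congˡ (eval-replicate-0# Q-1 y))) (+-comm _ _)

    distinct : ∀ {i j} → i < Q → j < Q → r i ≈ r j → i ≡ j
    distinct i<Q j<Q = pow-injective ω-primitive Q>0 i<Q j<Q ∘ *-cancelˡ ρ≉0

    roots : ∀ {i} → i < Q → eval cs (r i) ≈ 0#
    roots {i} _ = begin
      eval cs (r i)                        ≈⟨ eval-cs (r i) ⟩
      pow R (ρ * pow R ω i) Q - ρ^Q        ≈⟨ +-congʳ (pow-distrib-* ρ (pow R ω i) Q) ⟩
      ρ^Q * pow R (pow R ω i) Q - ρ^Q      ≈⟨ +-congʳ (*-congˡ (pow-assocʳ ω i Q)) ⟩
      ρ^Q * pow R ω (i ℕ.* Q) - ρ^Q        ≈⟨ +-congʳ (*-congˡ (pow-multiple≈1 ω-primitive i)) ⟩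
      ρ^Q * 1# - ρ^Q                       ≈⟨ +-congʳ (*-identityʳ ρ^Q) ⟩
      ρ^Q - ρ^Q                            ≈⟨ -‿inverseʳ ρ^Q ⟩
      0#                                   ∎

  geometric-sum : ∀ k y → y * eval (replicate k 1#) y + 1# ≈ eval (replicate k 1#) y + pow R y (suc k)
  geometric-sum zero    y = +-comm _ _
  geometric-sum (suc k) y = begin
    y * (1# + y * G) + 1#         ≈⟨ shift y G 1# ⟩
    1# + y * (y * G + 1#)         ≈⟨ +-congˡ (*-congˡ (geometric-sum k y)) ⟩
    1# + y * (G + yᵏ⁺¹)           ≈⟨ +-congˡ (distribˡ y G yᵏ⁺¹) ⟩
    1# + (y * G + y * yᵏ⁺¹)       ≈⟨ +-assoc 1# _ _ ⟨
    1# + y * G + y * yᵏ⁺¹         ∎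
    where
    G = eval (replicate k 1#) y
    yᵏ⁺¹ = pow R y (suc k)
    shift : ∀ y G u → y S.* (u S.+ y S.* G) S.+ u S.≈ u S.+ y S.* (y S.* G S.+ u)
    shift = solve-∀ acr

  eval-replicate-1#-at-1# : ∀ k → eval (replicate k 1#) 1# ≈ fromℕ R (suc k)
  eval-replicate-1#-at-1# zero    = sym (+-identityʳ 1#)
  eval-replicate-1#-at-1# (suc k) = +-congˡ (trans (*-identityˡ _) (eval-replicate-1#-at-1# k))

  ∏<-1-ω^[1+t] : ∀ {k ω} → PrimitiveRoot R (suc k) ω →
                 ∏< k (λ t → 1# - pow R ω (suc t)) ≈ fromℕ R (suc k)
  ∏<-1-ω^[1+t] {k} {ω} ω-primitive = begin
    ∏< k (λ t → 1# - r t)          ≈⟨ eval≈∏<roots k (replicate k 1#) r distinct roots 1# ⟨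
    eval (replicate k 1#) 1#       ≈⟨ eval-replicate-1#-at-1# k ⟩
    fromℕ R (suc k)                ∎
    where
    r : ℕ → Carrier
    r t = pow R ω (suc t)

    distinct : ∀ {i j} → i < k → j < k → r i ≈ r j → i ≡ j
    distinct i<k j<k = ℕ.suc-injective ∘ pow-injective ω-primitive z<s (s<s i<k) (s<s j<k)

    roots : ∀ {i} → i < k → eval (replicate k 1#) (r i) ≈ 0#
    roots {i} i<k = x*y≈y⇒y≈0 (proj₂ ω-primitive (suc i) z<s (s<s i<k))
      (+-cancelʳ 1# _ _ (trans (geometric-sum k (r i)) (+-congˡ (begin
        pow R (r i) (suc k)             ≈⟨ pow-assocʳ ω (suc i) (suc k) ⟩
        pow R ω (suc i ℕ.* suc k)       ≈⟨ pow-multiple≈1 ω-primitive (suc i) ⟩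
        1#                              ∎))))

module UnitaryCyclotomic {c ℓ} (R : CommutativeRing c ℓ) (domain : IsIntegralDomain R) where

  open CommutativeRing R
  open IntegralDomain R domain
  open import Relation.Binary.Reasoning.Setoid setoid
  open import Algebra.Properties.Ring ring using (x∙y⁻¹≈ε⇒x≈y)

  factor : Bool → Carrier → Carrier
  factor b v = if b then v else 1#

  factor-cong : ∀ {a b v w} → a ≡ b → v ≈ w → factor a v ≈ factor b w
  factor-cong {true}  ≡.refl v≈w = v≈w
  factor-cong {false} ≡.refl _   = refl

  factor-∧-split : ∀ a b v → factor a v ≈ factor (a ∧ not b) v * factor (a ∧ b) v
  factor-∧-split false _     _ = sym (*-identityˡ 1#)
  factor-∧-split true  false v = sym (*-identityʳ v)
  factor-∧-split true  true  v = sym (*-identityˡ v)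

  factor-unitaryCoprime : ∀ {k n v} → 0 < n → UnitaryCoprime k n → factor (isUnitaryCoprime k n) v ≈ v
  factor-unitaryCoprime {k} {n} n>0 uc with isUnitaryCoprime k n in eq
  ... | true  = refl
  ... | false = ⊥-elim (≡.subst T eq (Equivalence.from (T-isUnitaryCoprime⇔ n>0) uc))

  factor-¬unitaryCoprime : ∀ {k n v} → 0 < n → ¬ UnitaryCoprime k n → factor (isUnitaryCoprime k n) v ≈ 1#
  factor-¬unitaryCoprime n>0 ¬uc = factor-cong (isUnitaryCoprime-false n>0 ¬uc) refl

  ∏<-factor : ∀ n b v → ∏< n (λ t → factor b (v t)) ≈ factor b (∏< n v)
  ∏<-factor n true  v = refl
  ∏<-factor n false v = ∏<-identity n

  foldr-filterᵇ : ∀ (P : ℕ → Bool) (h : ℕ → Carrier) xs →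
                  foldr (λ j acc → h j * acc) 1# (filterᵇ P xs) ≈
                  foldr (λ j acc → factor (P j) (h j) * acc) 1# xs
  foldr-filterᵇ P h []       = refl
  foldr-filterᵇ P h (x ∷ xs) with P x
  ... | true  = *-congˡ (foldr-filterᵇ P h xs)
  ... | false = trans (foldr-filterᵇ P h xs) (sym (*-identityˡ _))

  foldr-applyUpTo : ∀ n (h : ℕ → Carrier) (f : ℕ → ℕ) →
                    foldr (λ j acc → h j * acc) 1# (applyUpTo f n) ≡ ∏< n (h ∘ f)
  foldr-applyUpTo zero    h f = ≡.refl
  foldr-applyUpTo (suc n) h f = ≡.cong (h (f 0) *_) (foldr-applyUpTo n h (f ∘ suc))

  -- Indices run over 0 ≤ k < n instead of 1 ≤ j ≤ n: the factor for j = n equals the one for k = 0,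
  -- because ζ^n = 1 and (n, n)_* = (0, n)_*.
  Φ* : ℕ → Carrier → Carrier → Carrier
  Φ* n ζ x = ∏< n (λ k → factor (isUnitaryCoprime k n) (x - pow R ζ k))

  unitaryCyclotomicAt≈Φ* : ∀ {n ζ} x → 0 < n → PrimitiveRoot R n ζ →
                           unitaryCyclotomicAt R n ζ x ≈ Φ* n ζ x
  unitaryCyclotomicAt≈Φ* {n} {ζ} x n>0 (ζⁿ≈1 , _) = begin
    unitaryCyclotomicAt R n ζ x
      ≈⟨ foldr-filterᵇ (λ j → isUnitaryCoprime j n) (λ j → x - pow R ζ j) (map suc (upTo n)) ⟩
    foldr (λ j acc → f j * acc) 1# (map suc (upTo n))
      ≡⟨ ≡.cong (foldr (λ j acc → f j * acc) 1#) (map-applyUpTo (λ k → k) suc n) ⟩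
    foldr (λ j acc → f j * acc) 1# (applyUpTo suc n)
      ≡⟨ foldr-applyUpTo n f suc ⟩
    ∏< n (f ∘ suc)
      ≈⟨ ∏<-rotate n f fn≈f0 ⟩
    Φ* n ζ x
      ∎
    where
    f : ℕ → Carrier
    f k = factor (isUnitaryCoprime k n) (x - pow R ζ k)

    fn≈f0 : f n ≈ f 0
    fn≈f0 = factor-cong (isUnitaryCoprime-≡ n>0 n>0 unitaryCoprime-self⇔0) (+-congˡ (-‿cong ζⁿ≈1))

  Φ*-congʳ : ∀ n ζ {x y} → x ≈ y → Φ* n ζ x ≈ Φ* n ζ y
  Φ*-congʳ n ζ x≈y = ∏<-cong n (λ _ → factor-cong ≡.refl (+-congʳ x≈y))

  Φ*-nonzero : ∀ {n ζ x} → 0 < n → (∀ {k} → k < n → UnitaryCoprime k n → ¬ x ≈ pow R ζ k) →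
               ¬ Φ* n ζ x ≈ 0#
  Φ*-nonzero {n} {ζ} {x} n>0 x≉ζᵏ = ∏<-nonzero n factor≉0
    where
    factor≉0 : ∀ {k} → k < n → ¬ factor (isUnitaryCoprime k n) (x - pow R ζ k) ≈ 0#
    factor≉0 {k} k<n with isUnitaryCoprime k n in eq
    ... | true  = x≉ζᵏ k<n (Equivalence.to (T-isUnitaryCoprime⇔ n>0) (≡.subst T (≡.sym eq) _))
                ∘ x∙y⁻¹≈ε⇒x≈y x (pow R ζ k)
    ... | false = 1#≉0#

  module PrimePowerStep {p E m ζ} (p-prime : Prime p) (E≥1 : 1 ≤ E) (p∤m : ¬ p ∣ m)
                        (ζ-primitive : PrimitiveRoot R (p ℕ.^ E ℕ.* m) ζ) where

    private
      q = p ℕ.^ E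
      n = q ℕ.* m

      q>0 : 0 < q
      q>0 = ℕ.m^n>0 p {{prime⇒nonZero p-prime}} E

      m>0 : 0 < m
      m>0 = ∤⇒>0 p∤m

      n>0 : 0 < n
      n>0 = ℕ.*-mono-≤ q>0 m>0

      ω : Carrier
      ω = pow R ζ m

      ω-primitive : PrimitiveRoot R q ω
      ω-primitive = primitive-pow m>0 (≡.subst (λ k → PrimitiveRoot R k ζ) (ℕ.*-comm q m) ζ-primitive)

      u : ℕ → Bool
      u k = isUnitaryCoprime k m

      v : Carrier → ℕ → Carrier
      v x k = x - pow R ζ k

      ζ^[ab]≈[ζ^b]^a : ∀ a b → pow R ζ (a ℕ.* b) ≈ pow R (pow R ζ b) a
      ζ^[ab]≈[ζ^b]^a a b = trans (reflexive (≡.cong (pow R ζ) (ℕ.*-comm a b))) (sym (pow-assocʳ ζ b a))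

    η : Carrier
    η = pow R ζ q

    η-primitive : PrimitiveRoot R m η
    η-primitive = primitive-pow q>0 ζ-primitive

    private
      Φ*-at-pow : ∀ x → Φ* m η (pow R x q) ≈ ∏< n (λ k → factor (u k) (v x k))
      Φ*-at-pow x = begin
        ∏< m (λ r → factor (u r) (pow R x q - pow R η r))
          ≈⟨ ∏<-cong m (λ {r} _ → factor-cong ≡.refl (orbit r)) ⟩
        ∏< m (λ r → factor (u r) (∏< q (λ t → x - pow R ζ r * pow R ω t)))
          ≈⟨ ∏<-cong m (λ {r} _ → ∏<-factor q (u r) _) ⟨
        ∏< m (λ r → ∏< q (λ t → factor (u r) (x - pow R ζ r * pow R ω t)))
          ≈⟨ ∏<-comm m q _ ⟩
        ∏< q (λ t → ∏< m (λ r → factor (u r) (x - pow R ζ r * pow R ω t)))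
          ≈⟨ ∏<-cong q (λ {t} _ → ∏<-cong m (λ {r} _ →
               factor-cong (periodic t r) (+-congˡ (-‿cong (shift t r))))) ⟨
        ∏< q (λ t → ∏< m (λ r → factor (u (t ℕ.* m ℕ.+ r)) (v x (t ℕ.* m ℕ.+ r))))
          ≈⟨ ∏<-* q m _ ⟨
        ∏< n (λ k → factor (u k) (v x k))
          ∎
        where
        orbit : ∀ r → pow R x q - pow R η r ≈ ∏< q (λ t → x - pow R ζ r * pow R ω t)
        orbit r = trans (+-congˡ (-‿cong (trans (pow-assocʳ ζ q r) (ζ^[ab]≈[ζ^b]^a q r))))
                        (x^Q-ρ^Q≈∏< q>0 ω-primitive (pow-nonzero r (primitive⇒nonzero ζ-primitive n>0)) x)

        periodic : ∀ t r → u (t ℕ.* m ℕ.+ r) ≡ u r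
        periodic t r = isUnitaryCoprime-≡ m>0 m>0 (unitaryCoprime-periodic t)

        shift : ∀ t r → pow R ζ (t ℕ.* m ℕ.+ r) ≈ pow R ζ r * pow R ω t
        shift t r = trans (pow-homo-* ζ (t ℕ.* m) r) (trans (*-congʳ (ζ^[ab]≈[ζ^b]^a t m)) (*-comm _ _))

      Φ*-split : ∀ x → ∏< n (λ k → factor (u k) (v x k)) ≈
                       Φ* n ζ x * ∏< n (λ k → factor (u k ∧ does (q ∣? k)) (v x k))
      Φ*-split x = trans (∏<-cong n (λ {k} _ → split k)) (∏<-distrib n _ _)
        where
        split : ∀ k → factor (u k) (v x k) ≈
                      factor (isUnitaryCoprime k n) (v x k) * factor (u k ∧ does (q ∣? k)) (v x k)
        split k = trans (factor-∧-split (u k) (does (q ∣? k)) (v x k))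
                        (*-congʳ (factor-cong (≡.sym (isUnitaryCoprime-primePower* p-prime E≥1 p∤m)) refl))

      Φ*-dilate : ∀ x → ∏< n (λ k → factor (u k ∧ does (q ∣? k)) (v x k)) ≈ Φ* m η x
      Φ*-dilate x = begin
        ∏< n g                                       ≡⟨ ≡.cong (λ N → ∏< N g) (ℕ.*-comm q m) ⟩
        ∏< (m ℕ.* q) g                               ≈⟨ ∏<-* m q g ⟩
        ∏< m (λ t → ∏< q (λ r → g (t ℕ.* q ℕ.+ r)))  ≈⟨ ∏<-cong m (λ {t} _ → ∏<-head _ q>0 (off t)) ⟩
        ∏< m (λ t → g (t ℕ.* q ℕ.+ 0))               ≈⟨ ∏<-cong m (λ {t} _ → on t) ⟩
        Φ* m η x                                     ∎
        where
        g : ℕ → Carrier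
        g k = factor (u k ∧ does (q ∣? k)) (v x k)

        off : ∀ t {r} → suc r < q → g (t ℕ.* q ℕ.+ suc r) ≈ 1#
        off t {r} r<q = factor-cong
          (≡.trans (≡.cong (u (t ℕ.* q ℕ.+ suc r) ∧_) (dec-false (q ∣? _) q∤)) (∧-zeroʳ _)) refl
          where
          q∤ : ¬ q ∣ t ℕ.* q ℕ.+ suc r
          q∤ q∣ = ℕ.<⇒≱ r<q (∣⇒≤ (∣m+n∣m⇒∣n q∣ (n∣m*n t)))

        on : ∀ t → g (t ℕ.* q ℕ.+ 0) ≈ factor (u t) (x - pow R η t)
        on t rewrite ℕ.+-identityʳ (t ℕ.* q) =
          factor-cong (≡.trans (≡.cong (u (t ℕ.* q) ∧_) (dec-true (q ∣? _) (n∣m*n t)))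
                               (≡.trans (∧-identityʳ (u (t ℕ.* q))) u[tq]≡u[t]))
                      (+-congˡ (-‿cong (ζ^[ab]≈[ζ^b]^a t q)))
          where
          u[tq]≡u[t] : u (t ℕ.* q) ≡ u t
          u[tq]≡u[t] = isUnitaryCoprime-≡ m>0 m>0
                         (unitaryCoprime-*ʳ t (coprime-^ˡ E (prime∤⇒coprime p-prime p∤m)))

    Φ*-step : ∀ x → Φ* n ζ x * Φ* m η x ≈ Φ* m η (pow R x q)
    Φ*-step x = begin
      Φ* n ζ x * Φ* m η x                                                 ≈⟨ *-congˡ (Φ*-dilate x) ⟨
      Φ* n ζ x * ∏< n (λ k → factor (u k ∧ does (q ∣? k)) (v x k))       ≈⟨ Φ*-split x ⟨
      ∏< n (λ k → factor (u k) (v x k))                                   ≈⟨ Φ*-at-pow x ⟨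
      Φ* m η (pow R x q)                                                  ∎

  Φ*-1 : ∀ {n ζ} x → n ≡ 1 → Φ* n ζ x ≈ x - 1#
  Φ*-1 x ≡.refl = *-identityʳ (x - 1#)

  Φ*-2^a[-1]≈0 : ∀ {a n ζ} → 1 ≤ a → n ≡ 2 ℕ.^ a → PrimitiveRoot R n ζ → Φ* n ζ (- 1#) ≈ 0#
  Φ*-2^a[-1]≈0 {suc b} {ζ = ζ} _ ≡.refl ζ-primitive = ∏<-zero n k<n (begin
    factor (isUnitaryCoprime k n) (- 1# - pow R ζ k)   ≈⟨ factor-unitaryCoprime (ℕ.m^n>0 2 (suc b)) k-coprime ⟩
    - 1# - pow R ζ k                                   ≈⟨ +-congˡ (-‿cong ζᵏ≈-1) ⟩
    - 1# - - 1#                                        ≈⟨ -‿inverseʳ (- 1#) ⟩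
    0#                                                 ∎)
    where
    k = 2 ℕ.^ b
    n = 2 ℕ.^ suc b

    k>0 : 0 < k
    k>0 = ℕ.m^n>0 2 b

    n≡k+k : n ≡ k ℕ.+ k
    n≡k+k = ≡.cong (k ℕ.+_) (ℕ.+-identityʳ k)

    k<n : k < n
    k<n = ≡.subst (k <_) (≡.sym n≡k+k) (ℕ.m<m+n k k>0)

    k-coprime : UnitaryCoprime k n
    k-coprime = unitaryCoprime-primePower {E = suc b} prime[2] z<s (ℕ.<⇒≱ k<n ∘ ∣⇒≤ {{ℕ.>-nonZero k>0}})

    ζᵏ≈-1 : pow R ζ k ≈ - 1#
    ζᵏ≈-1 = x²≈1⇒x≈-1
      (trans (sym (pow-homo-* ζ k k))
             (trans (reflexive (≡.cong (pow R ζ) (≡.sym n≡k+k))) (proj₁ ζ-primitive)))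
      (proj₂ ζ-primitive k k>0 k<n)

  Φ*[1]≈n : ∀ {n ζ} → 0 < n → PrimitiveRoot R n ζ → ¬ UnitaryCoprime 0 n →
            (∀ {k} → 0 < k → k < n → UnitaryCoprime k n) → Φ* n ζ 1# ≈ fromℕ R n
  Φ*[1]≈n {suc n} {ζ} n>0 ζ-primitive ¬uc0 uc = begin
    factor (isUnitaryCoprime 0 (suc n)) (1# - pow R ζ 0) *
    ∏< n (λ t → factor (isUnitaryCoprime (suc t) (suc n)) (1# - pow R ζ (suc t)))
      ≈⟨ *-cong (factor-¬unitaryCoprime n>0 ¬uc0)
                (∏<-cong n (λ t<n → factor-unitaryCoprime n>0 (uc z<s (s<s t<n)))) ⟩
    1# * ∏< n (λ t → 1# - pow R ζ (suc t))      ≈⟨ *-identityˡ _ ⟩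
    ∏< n (λ t → 1# - pow R ζ (suc t))           ≈⟨ ∏<-1-ω^[1+t] ζ-primitive ⟩
    fromℕ R (suc n)                             ∎

  Φ*-p^b[1]≈p^b : ∀ {p b ζ} → Prime p → 1 ≤ b → PrimitiveRoot R (p ℕ.^ b) ζ →
                  Φ* (p ℕ.^ b) ζ 1# ≈ fromℕ R (p ℕ.^ b)
  Φ*-p^b[1]≈p^b {p} {b} p-prime b≥1 ζ-primitive =
    Φ*[1]≈n (ℕ.m^n>0 p {{prime⇒nonZero p-prime}} b) ζ-primitive
      (¬unitaryCoprime-0 (prime^≢1 p-prime b≥1))
      (λ k>0 k<Q → unitaryCoprime-primePower p-prime b≥1 (ℕ.<⇒≱ k<Q ∘ ∣⇒≤ {{ℕ.>-nonZero k>0}}))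

  Φ*-odd[-1]≈1 : ∀ {n ζ} → ¬ 1# + 1# ≈ 0# → ¬ 2 ∣ n → n ≢ 1 → PrimitiveRoot R n ζ →
                 Φ* n ζ (- 1#) ≈ 1#
  Φ*-odd[-1]≈1 {n} {ζ} 2≉0 2∤n n≢1 ζ-primitive with primePowerFactor (∤⇒>0 2∤n) n≢1
  ... | p , E , m , p-prime , E≥1 , p∤m , ≡.refl = *-identityˡ-unique Y≉0 (begin
    Φ* n ζ (- 1#) * Y               ≈⟨ Φ*-step (- 1#) ⟩
    Φ* m η (pow R (- 1#) (p ℕ.^ E)) ≈⟨ Φ*-congʳ m η (pow-[-1]-odd 2∤q) ⟩
    Y                               ∎)
    where
    open PrimePowerStep p-prime E≥1 p∤m ζ-primitive

    Y = Φ* m η (- 1#)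

    2∤q : ¬ 2 ∣ p ℕ.^ E
    2∤q 2∣q = 2∤n (∣-trans 2∣q (m∣m*n m))

    2∤m : ¬ 2 ∣ m
    2∤m 2∣m = 2∤n (∣-trans 2∣m (n∣m*n (p ℕ.^ E)))

    Y≉0 : ¬ Y ≈ 0#
    Y≉0 = Φ*-nonzero (∤⇒>0 p∤m) λ {k} _ _ -1≈ηᵏ → 2≉0 (trans (+-congˡ (sym (begin
      - 1#                  ≈⟨ pow-[-1]-odd 2∤m ⟨
      pow R (- 1#) m        ≈⟨ pow-congˡ m -1≈ηᵏ ⟩
      pow R (pow R η k) m   ≈⟨ pow-assocʳ η k m ⟩
      pow R η (k ℕ.* m)     ≈⟨ pow-multiple≈1 η-primitive k ⟩
      1#                    ∎))) (-‿inverseʳ 1#))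

  Φ*-p^E·m[1]≈1 : ∀ {p E m ζ} → Prime p → 1 ≤ E → ¬ p ∣ m → m ≢ 1 →
                  PrimitiveRoot R (p ℕ.^ E ℕ.* m) ζ → Φ* (p ℕ.^ E ℕ.* m) ζ 1# ≈ 1#
  Φ*-p^E·m[1]≈1 {p} {E} {m} p-prime E≥1 p∤m m≢1 ζ-primitive =
    *-identityˡ-unique (Φ*-nonzero (∤⇒>0 p∤m) 1≉ηᵏ)
                       (trans (Φ*-step 1#) (Φ*-congʳ m η (pow-1# (p ℕ.^ E))))
    where
    open PrimePowerStep p-prime E≥1 p∤m ζ-primitive

    1≉ηᵏ : ∀ {k} → k < m → UnitaryCoprime k m → ¬ 1# ≈ pow R η k
    1≉ηᵏ {zero}  _   uc = λ _ → ¬unitaryCoprime-0 m≢1 uc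
    1≉ηᵏ {suc k} k<m _  = proj₂ η-primitive (suc k) z<s k<m ∘ sym

  Φ*-2^a·m[-1]≈Φ*[1] : ∀ {a m ζ} → ¬ 1# + 1# ≈ 0# → 1 ≤ a → ¬ 2 ∣ m → m ≢ 1 →
                       PrimitiveRoot R (2 ℕ.^ a ℕ.* m) ζ →
                       Φ* (2 ℕ.^ a ℕ.* m) ζ (- 1#) ≈ Φ* m (pow R ζ (2 ℕ.^ a)) 1#
  Φ*-2^a·m[-1]≈Φ*[1] {suc b} {m} {ζ} 2≉0 a≥1 2∤m m≢1 ζ-primitive = begin
    Φ* n ζ (- 1#)                           ≈⟨ *-identityʳ _ ⟨
    Φ* n ζ (- 1#) * 1#                      ≈⟨ *-congˡ (Φ*-odd[-1]≈1 2≉0 2∤m m≢1 η-primitive) ⟨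
    Φ* n ζ (- 1#) * Φ* m η (- 1#)           ≈⟨ Φ*-step (- 1#) ⟩
    Φ* m η (pow R (- 1#) (2 ℕ.^ suc b))     ≈⟨ Φ*-congʳ m η (pow-[-1]-even (2 ℕ.^ b)) ⟩
    Φ* m η 1#                               ∎
    where
    open PrimePowerStep prime[2] a≥1 2∤m ζ-primitive
    n = 2 ℕ.^ suc b ℕ.* m

  Φ*-2^a·p^b[-1]≈p^b : ∀ {p a b n ζ} → ¬ 1# + 1# ≈ 0# → Prime p → ¬ 2 ∣ p → 1 ≤ a → 1 ≤ b →
                       n ≡ 2 ℕ.^ a ℕ.* p ℕ.^ b → PrimitiveRoot R n ζ →
                       Φ* n ζ (- 1#) ≈ fromℕ R (p ℕ.^ b)
  Φ*-2^a·p^b[-1]≈p^b {p} {a} {b} 2≉0 p-prime 2∤p a≥1 b≥1 ≡.refl ζ-primitive =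
    trans (Φ*-2^a·m[-1]≈Φ*[1] 2≉0 a≥1 2∤p^b (prime^≢1 p-prime b≥1) ζ-primitive)
          (Φ*-p^b[1]≈p^b p-prime b≥1 (primitive-pow (ℕ.m^n>0 2 a) ζ-primitive))
    where
    2∤p^b : ¬ 2 ∣ p ℕ.^ b
    2∤p^b = 2∤p ∘ prime∣^⇒∣ b prime[2]

  Φ*[-1]≈1 : ∀ {n ζ} → ¬ 1# + 1# ≈ 0# → 0 < n → PrimitiveRoot R n ζ → n ≢ 1 →
             ¬ (∃[ a ] (1 ≤ a × n ≡ 2 ℕ.^ a)) →
             ¬ (∃[ p ] ∃[ a ] ∃[ b ]
                  (Prime p × p ℕ.% 2 ≡ 1 × 1 ≤ a × 1 ≤ b × n ≡ 2 ℕ.^ a ℕ.* p ℕ.^ b)) →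
             Φ* n ζ (- 1#) ≈ 1#
  Φ*[-1]≈1 {n} 2≉0 n>0 ζ-primitive n≢1 ¬2^a ¬2^a·p^b with factorOut {2} (s≤s (s≤s z≤n)) n>0
  ... | zero , m , ≡.refl , 2∤m =
    Φ*-odd[-1]≈1 2≉0 (2∤m ∘ ≡.subst (2 ∣_) (ℕ.+-identityʳ m)) n≢1 ζ-primitive
  ... | suc a , m , ≡.refl , 2∤m with m ℕ.≟ 1
  ...   | yes ≡.refl = ⊥-elim (¬2^a (suc a , z<s , ℕ.*-identityʳ _))
  ...   | no m≢1 with primePowerFactor (∤⇒>0 2∤m) m≢1
  ...     | p , E , m′ , p-prime , E≥1 , p∤m′ , ≡.refl with m′ ℕ.≟ 1
  ...       | yes ≡.refl = ⊥-elim (¬2^a·p^b (p , suc a , E , p-prime , odd⇒%2≡1 2∤p , z<s , E≥1 ,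
                                             ≡.cong (2 ℕ.^ suc a ℕ.*_) (ℕ.*-identityʳ _)))
    where
    2∤p : ¬ 2 ∣ p
    2∤p 2∣p = 2∤m (∣-trans 2∣p (∣-trans (m∣m^n E≥1) (m∣m*n 1)))
  ...       | no m′≢1 =
    trans (Φ*-2^a·m[-1]≈Φ*[1] {suc a} 2≉0 z<s 2∤m m≢1 ζ-primitive)
          (Φ*-p^E·m[1]≈1 p-prime E≥1 p∤m′ m′≢1 (primitive-pow (ℕ.m^n>0 2 (suc a)) ζ-primitive))

open import Data.Nat using (_^_; _*_; _%_)

lemma3 : ∀ {c ℓ : Level} (R : CommutativeRing c ℓ) →
    IsIntegralDomain R → CharZero R →
    ∀ (n : ℕ) (ζ : CommutativeRing.Carrier R) → 0 < n → PrimitiveRoot R n ζ →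
    ((n ≡ 1) → EqR R (unitaryCyclotomicAt R n ζ (minusOne R)) (minusTwo R))
    × (∀ (a : ℕ) → 1 ≤ a → n ≡ 2 ^ a → EqR R (unitaryCyclotomicAt R n ζ (minusOne R)) (CommutativeRing.0# R))
    × (∀ (p a b : ℕ) → Prime p → p % 2 ≡ 1 → 1 ≤ a → 1 ≤ b → n ≡ 2 ^ a * p ^ b →
         EqR R (unitaryCyclotomicAt R n ζ (minusOne R)) (fromℕ R (p ^ b)))
    × (¬ (n ≡ 1) →
       ¬ (∃[ a ] (1 ≤ a × n ≡ 2 ^ a)) →
       ¬ (∃[ p ] ∃[ a ] ∃[ b ] (Prime p × p % 2 ≡ 1 × 1 ≤ a × 1 ≤ b × n ≡ 2 ^ a * p ^ b)) →
       EqR R (unitaryCyclotomicAt R n ζ (minusOne R)) (CommutativeRing.1# R))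
lemma3 R domain charZero n ζ n>0 ζ-primitive =
    (λ n≡1 → trans Φ*≈ (trans (Φ*-1 (- 1#) n≡1) (-‿+-comm 1# 1#)))
  , (λ a a≥1 n≡2^a → trans Φ*≈ (Φ*-2^a[-1]≈0 a≥1 n≡2^a ζ-primitive))
  , (λ p a b p-prime p%2≡1 a≥1 b≥1 n≡2^a·p^b →
       trans Φ*≈ (Φ*-2^a·p^b[-1]≈p^b 2≉0 p-prime (%2≡1⇒odd p%2≡1) a≥1 b≥1 n≡2^a·p^b ζ-primitive))
  , (λ n≢1 ¬2^a ¬2^a·p^b → trans Φ*≈ (Φ*[-1]≈1 2≉0 n>0 ζ-primitive n≢1 ¬2^a ¬2^a·p^b))
  where
  open CommutativeRing R
  open UnitaryCyclotomic R domain
  open import Algebra.Properties.Ring ring using (-‿+-comm)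

  Φ*≈ : unitaryCyclotomicAt R n ζ (- 1#) ≈ Φ* n ζ (- 1#)
  Φ*≈ = unitaryCyclotomicAt≈Φ* (- 1#) n>0 ζ-primitive

  2≉0 : ¬ 1# + 1# ≈ 0#
  2≉0 = charZero 1 ∘ trans (+-congˡ (+-identityʳ 1#))
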